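{- Let $\rho$ be a code retrieving function, $p$ a term, and $R,P,Q,Q',G$ state relations. Assume (1) $\rho\models_{rel}\{R,\mathrm{id}\}\,p\,\{Q',G\}$, (2) $P;Q'\subseteq Q$. Then $\rho\models_{rel}\{R,P\}\,p\,\{Q,G\}$.
   Context: Program terms over a state type $\alpha$ are generated by $p::=\mathbf{skip}\mid\mathbf{basic}\,f\mid\mathbf{cjump}\,C\,i\,p\mid\mathbf{while}\,C\,p\,p\mid\mathbf{if}\,C\,p\,p\mid p;p\mid\Vert(p_1,\dots,p_m)\mid\mathbf{await}\,C\,p$ ($f:\alpha\to\alpha$, $C\subseteq\alpha$, $i\in\mathbb N$, $m\ge1$). A code retrieving function $\rho$ maps $\mathbb N$ to terms. The program step relation $\rho\vdash(p,\sigma)\to_{\mathcal P}(p',\sigma')$ is the least relation with: $(\mathbf{basic}\,f,\sigma)\to(\mathbf{skip},f\sigma)$; $(\mathbf{cjump}\,C\,i\,p,\sigma)\to(\rho\,i,\sigma)$ if $\sigma\in C$, $\to(p,\sigma)$ otherwise; $(\mathbf{await}\,C\,p,\sigma)\to(\mathbf{skip},\sigma')$ if $\sigma\in C$ and $(p,\sigma)\to^*(\mathbf{skip},\sigma')$; $(\mathbf{if}\,C\,p_1\,p_2,\sigma)\to(p_1,\sigma)$ if $\sigma\in C$, $\to(p_2,\sigma)$ otherwise; for $x=\mathbf{while}\,C\,p_1\,p_2$: $(x,\sigma)\to(p_1;(\mathbf{skip};x),\sigma)$ if $\sigma\in C$, $\to(p_2,\sigma)$ otherwise; $(p_1;p_2,\sigma)\to(p_1';p_2,\sigma')$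 if $(p_1,\sigma)\to(p_1',\sigma')$; $(\mathbf{skip};p,\sigma)\to(p,\sigma)$; $(\Vert(\dots,p_i,\dots),\sigma)\to(\Vert(\dots,p_i',\dots),\sigma')$ if $(p_i,\sigma)\to(p_i',\sigma')$; $(\Vert(\mathbf{skip},\dots,\mathbf{skip}),\sigma)\to(\mathbf{skip},\sigma)$. A finite potential computation of $(\rho,p)$ is a nonempty finite sequence $(p_0,\sigma_0),\dots,(p_{n-1},\sigma_{n-1})$ with $p_0=p$ where each transition is a program step or an environment step ($p_{i+1}=p_i$, state arbitrary). For state relations $R,G$ and state predicates $P,Q$, $\rho\models\{R,P\}\,p\,\{Q,G\}$ means: every finite potential computation of $(\rho,p)$ with $\sigma_0\in P$ and $(\sigma_i,\sigma_{i+1})\in R$ for all environment steps has $(\sigma_i,\sigma_{i+1})\in G$ for all program steps and, if some $p_i=\mathbf{skip}$, $\sigma_i\in Q$ for the least such $i$. For state relations $P,Q$, $\rho\models_{rel}\{R,P\}\,p\,\{Q,G\}$ means that $\rho\models\{R,P(\{\sigma_0\})\}\,p\,\{Q(\{\sigma_0\}),G\}$ holds for every state $\sigma_0$, where $S(X)=\{b\mid\exists a\in X.(a,b)\in S\}$. $\mathrm{id}$ is the identity relation and $r;s=\{(a,b)\mid\exists c.(a,c)\in r\wedge(c,b)\in s\}$. -}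

module Defs where

open import Data.Nat using (ℕ; zero; suc; _<_)
open import Data.Fin using (Fin)
open import Data.Vec using (Vec; lookup; _[_]≔_)
open import Data.Vec.Relation.Unary.All using (All)
open import Data.Product using (Σ; _×_; _,_; proj₁; proj₂; ∃)
open import Data.Unit using (⊤)
open import Relation.Nullary using (¬_)
open import Relation.Binary.PropositionalEquality using (_≡_; _≢_)

StatePred : Set → Set₁
StatePred α = α → Set

StateRel : Set → Set₁
StateRel α = α → α → Set

data Term (α : Set) : Set₁ where
  skip  : Term α
  basic : (α → α) → Term α
  cjump : StatePred α → ℕ → Term α → Term α
  while : StatePred α → Term α → Term α → Term α
  if    : StatePred α → Term α → Term α → Term α
  _⨾_   : Term α → Term α → Term α
  par   : ∀ {m} → Vec (Term α) (suc m) → Term α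
  await : StatePred α → Term α → Term α

CodeRet : Set → Set₁
CodeRet α = ℕ → Term α

Config : Set → Set₁
Config α = Term α × α

mutual
  data Step {α : Set} (ρ : CodeRet α) : Config α → Config α → Set₁ where
    basic-step   : ∀ {f σ} → Step ρ (basic f , σ) (skip , f σ)
    cjump-jump   : ∀ {C i p σ} → C σ → Step ρ (cjump C i p , σ) (ρ i , σ)
    cjump-fall   : ∀ {C i p σ} → ¬ C σ → Step ρ (cjump C i p , σ) (p , σ)
    await-step   : ∀ {C p σ σ'} → C σ → Steps ρ (p , σ) (skip , σ')
                   → Step ρ (await C p , σ) (skip , σ')
    if-true      : ∀ {C p₁ p₂ σ} → C σ → Step ρ (if C p₁ p₂ , σ) (p₁ , σ)
    if-false     : ∀ {C p₁ p₂ σ} → ¬ C σ → Step ρ (if C p₁ p₂ , σ) (p₂ , σ)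
    while-true   : ∀ {C p₁ p₂ σ} → C σ
                   → Step ρ (while C p₁ p₂ , σ) (p₁ ⨾ (skip ⨾ while C p₁ p₂) , σ)
    while-false  : ∀ {C p₁ p₂ σ} → ¬ C σ → Step ρ (while C p₁ p₂ , σ) (p₂ , σ)
    seq-step     : ∀ {p₁ p₁' p₂ σ σ'} → Step ρ (p₁ , σ) (p₁' , σ')
                   → Step ρ (p₁ ⨾ p₂ , σ) (p₁' ⨾ p₂ , σ')
    seq-skip     : ∀ {p σ} → Step ρ (skip ⨾ p , σ) (p , σ)
    par-step     : ∀ {m} {ps : Vec (Term α) (suc m)} (i : Fin (suc m)) {p' σ σ'}
                   → Step ρ (lookup ps i , σ) (p' , σ')
                   → Step ρ (par ps , σ) (par (ps [ i ]≔ p') , σ')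
    par-done     : ∀ {m} {ps : Vec (Term α) (suc m)} {σ}
                   → All (_≡ skip) ps → Step ρ (par ps , σ) (skip , σ)

  data Steps {α : Set} (ρ : CodeRet α) : Config α → Config α → Set₁ where
    done : ∀ {c} → Steps ρ c c
    more : ∀ {c c' c''} → Step ρ c c' → Steps ρ c' c'' → Steps ρ c c''

data Trans {α : Set} (ρ : CodeRet α) : Config α → Config α → Set₁ where
  prog : ∀ {c c'} → Step ρ c c' → Trans ρ c c'
  env  : ∀ {p σ σ'} → Trans ρ (p , σ) (p , σ')

envOK : ∀ {α} {ρ : CodeRet α} → StateRel α → ∀ {c c'} → Trans ρ c c' → Set
envOK R (prog _) = ⊤
envOK R (env {σ = σ} {σ' = σ'}) = R σ σ'

progOK : ∀ {α} {ρ : CodeRet α} → StateRel α → ∀ {c c'} → Trans ρ c c' → Set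
progOK G {c} {c'} (prog _) = G (proj₂ c) (proj₂ c')
progOK G env = ⊤

record PotComp {α : Set} (ρ : CodeRet α) (p : Term α) : Set₁ where
  field
    len   : ℕ                       -- n - 1
    cfg   : ℕ → Config α            -- only indices ≤ len are relevant
    start : proj₁ (cfg 0) ≡ p
    trans : ∀ i → i < len → Trans ρ (cfg i) (cfg (suc i))

open PotComp public

Valid : ∀ {α} → CodeRet α → StateRel α → StatePred α → Term α
        → StatePred α → StateRel α → Set₁
Valid ρ R P p Q G =
  (c : PotComp ρ p) →
  P (proj₂ (cfg c 0)) →
  (∀ i (h : i < len c) → envOK R (trans c i h)) →
  (∀ i (h : i < len c) → progOK G (trans c i h))
  × (∀ i → i < suc (len c) → proj₁ (cfg c i) ≡ skip
       → (∀ j → j < i → proj₁ (cfg c j) ≢ skip)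
       → Q (proj₂ (cfg c i)))

image : ∀ {α} → StateRel α → StatePred α → StatePred α
image S X b = ∃ λ a → X a × S a b

singleton : ∀ {α} → α → StatePred α
singleton σ₀ a = a ≡ σ₀

idRel : ∀ {α} → StateRel α
idRel = _≡_

_⨟_ : ∀ {α} → StateRel α → StateRel α → StateRel α
(r ⨟ s) a b = ∃ λ c → r a c × s c b

_⊆ᵣ_ : ∀ {α} → StateRel α → StateRel α → Set
r ⊆ᵣ s = ∀ a b → r a b → s a b

ValidRel : ∀ {α} → CodeRet α → StateRel α → StateRel α → Term α
           → StateRel α → StateRel α → Set₁
ValidRel ρ R P p Q G =
  ∀ σ₀ → Valid ρ R (image P (singleton σ₀)) p (image Q (singleton σ₀)) G

module Submission where

-- The proof uses two structural facts about plain validity: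
--   * the consequence rule (weaken the precondition, strengthen the postcondition);
--   * validity may be established separately for each initial state.
-- For a fixed σ₀ and an initial state a ∈ P({σ₀}), hypothesis (1) at reference
-- state a gives validity from {a} with postcondition Q'({a}), and Q'({a}) ⊆ Q({σ₀})
-- by (2), since (σ₀,a) ∈ P.

open import Defs
open import Data.Product using (_,_)
open import Relation.Binary.PropositionalEquality using (refl)

_⊆ₚ_ : ∀ {α} → StatePred α → StatePred α → Set
X ⊆ₚ Y = ∀ a → X a → Y a

valid-consequence : ∀ {α} {ρ : CodeRet α} {R G : StateRel α} {p : Term α}
  {P P' Q Q' : StatePred α}
  → P' ⊆ₚ P → Q ⊆ₚ Q'
  → Valid ρ R P p Q G → Valid ρ R P' p Q' G
valid-consequence P'⊆P Q⊆Q' valid c pre envs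
  with valid c (P'⊆P _ pre) envs
... | guar , post = guar , λ i i≤len isSkip firstSkip →
                      Q⊆Q' _ (post i i≤len isSkip firstSkip)

-- Validity is checked computation by computation, hence it suffices to
-- establish it for every single admissible initial state.
valid-pointwise : ∀ {α} {ρ : CodeRet α} {R G : StateRel α} {p : Term α}
  {P Q : StatePred α}
  → (∀ a → P a → Valid ρ R (singleton a) p Q G)
  → Valid ρ R P p Q G
valid-pointwise validAt c pre = validAt _ pre c refl

singleton-⊆-idImage : ∀ {α} (a : α) → singleton a ⊆ₚ image idRel (singleton a)
singleton-⊆-idImage a .a refl = a , refl , refl

image-⨟ : ∀ {α} {P Q' : StateRel α} {σ₀ a : α}
  → P σ₀ a → image Q' (singleton a) ⊆ₚ image (P ⨟ Q') (singleton σ₀)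
image-⨟ {a = a} Pσ₀a b (.a , refl , Q'ab) = _ , refl , (a , Pσ₀a , Q'ab)

image-mono : ∀ {α} {S T : StateRel α} {X : StatePred α}
  → S ⊆ᵣ T → image S X ⊆ₚ image T X
image-mono S⊆T b (a , Xa , Sab) = a , Xa , S⊆T a b Sab

mainTheorem15 : ∀ {α : Set} (ρ : CodeRet α) (p : Term α) (R P Q Q' G : StateRel α)
    → ValidRel ρ R idRel p Q' G
    → (P ⨟ Q') ⊆ᵣ Q
    → ValidRel ρ R P p Q G
mainTheorem15 ρ p R P Q Q' G validId P⨟Q'⊆Q σ₀ =
  valid-pointwise {P = image P (singleton σ₀)} {Q = image Q (singleton σ₀)}
    λ { a (.σ₀ , refl , Pσ₀a) →
      valid-consequence (singleton-⊆-idImage a)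
                        (λ b q' → image-mono P⨟Q'⊆Q b (image-⨟ {Q' = Q'} Pσ₀a b q'))
                        (validId a) }
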